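{- Let $G=(V,E)$ be an undirected graph, $k$ a positive integer, and $F_1,\ldots,F_k$ pairwise edge-disjoint forests in $G$ with $F=F_1\sqcup\cdots\sqcup F_k$. Let $L$ be the top clump of $F$, and let $U_1,\ldots,U_q$ be the vertex sets of the connected components of $L$ (each containing at least one edge). Let $G'$ be obtained from $G$ by contracting each $U_j$ to a single vertex and deleting self-loops, and let $F'_i=F_i-\bigcup_{j}\lambda(U_j)$ for $i\in[k]$ (edges of $G'$ are identified with edges of $G$ not inside any $U_j$), and $F'=F'_1\sqcup\cdots\sqcup F'_k$. Then the top clump of $F'$ (with respect to $k$, in $G'$) is empty, i.e. $F'$ has no nonempty clump.
   Context: For $S\subseteq V$, $\lambda(S)$ is the set of edges with both endpoints in $S$. For an edge set $A$ of an undirected graph, $\mathrm{rk}(A)$ is the number of edges in a spanning forest of $A$. Given an edge set $F$ and a positive integer $k$, a clump of $F$ is a set $L\subseteq F$ that can be covered by $k$ forests and satisfies $|L|=k\cdot\mathrm{rk}(L)$ (equivalently, each connected component of $L$ can be partitioned into $k$ spanning trees of that component). A top clump of $F$ is an inclusion-maximal clump of $F$; when $F$ is a union of $k$ edge-disjoint forests, the top clump is unique (a known result of Gabow and Westermann). -}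

module Defs where

open import Data.Nat using (ℕ; _*_)
open import Data.Fin using (Fin)
open import Data.Fin.Subset using (Subset; _∈_; _∉_; _⊆_; ∣_∣; Empty)
open import Data.Product using (Σ; ∃; ∃-syntax; _×_; _,_; proj₁; proj₂)
open import Data.Sum using (_⊎_)
open import Data.List using (List; []; _∷_)
open import Data.List.Relation.Unary.Unique.Propositional using (Unique)
open import Relation.Binary.PropositionalEquality using (_≡_; _≢_)
open import Relation.Nullary using (¬_)
open import Function.Bundles using (_⇔_)
open import Function.Definitions using (Surjective)

-- A (multi)graph on vertex set Fin n with edge set Fin m is given by the
-- endpoint map  ends : Fin m → Fin n × Fin n  (loops / parallel edges allowed).
-- Edge sets are subsets of Fin m.

Ends : ℕ → ℕ → Set
Ends n m = Fin m → Fin n × Fin n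

module _ {n m : ℕ} (ends : Ends n m) where

  src tgt : Fin m → Fin n
  src e = proj₁ (ends e)
  tgt e = proj₂ (ends e)

  Joins : Fin m → Fin n → Fin n → Set
  Joins e u w = (ends e ≡ (u , w)) ⊎ (ends e ≡ (w , u))

  data Walk (A : Subset m) : Fin n → Fin n → List (Fin m) → Set where
    [] : ∀ {v} → Walk A v v []
    step : ∀ {u w v e es} → e ∈ A → Joins e u w → Walk A w v es →
           Walk A u v (e ∷ es)

  Connected : Subset m → Fin n → Fin n → Set
  Connected A u v = ∃[ es ] Walk A u v es

  HasCycle : Subset m → Set
  HasCycle A = ∃[ v ] ∃[ e ] ∃[ es ] (Walk A v v (e ∷ es) × Unique (e ∷ es))

  IsForest : Subset m → Set
  IsForest A = ¬ HasCycle A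

  IsSpanningForest : Subset m → Subset m → Set
  IsSpanningForest A T =
    T ⊆ A × IsForest T × (∀ {e} → e ∈ A → Connected T (src e) (tgt e))

  HasRank : Subset m → ℕ → Set
  HasRank A r = ∃[ T ] (IsSpanningForest A T × ∣ T ∣ ≡ r)

  CoveredByForests : ℕ → Subset m → Set
  CoveredByForests k A =
    Σ (Fin k → Subset m) λ Ts → (((i : Fin k) → IsForest (Ts i)) ×
             (∀ {e} → e ∈ A → ∃[ i ] (e ∈ Ts i)))

  IsClump : ℕ → Subset m → Subset m → Set
  IsClump k F L =
    L ⊆ F × CoveredByForests k L × ∃[ r ] (HasRank L r × ∣ L ∣ ≡ k * r)

  IsTopClump : ℕ → Subset m → Subset m → Set
  IsTopClump k F L =
    IsClump k F L × (∀ L' → IsClump k F L' → L ⊆ L' → L' ⊆ L)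

  Incident : Subset m → Fin n → Set
  Incident L u = ∃[ e ] (e ∈ L × (src e ≡ u ⊎ tgt e ≡ u))

  -- e ∈ λ(U_j) for some component vertex set U_j of L
  InsideSomeComponent : Subset m → Fin m → Set
  InsideSomeComponent L e = Incident L (src e) × Connected L (src e) (tgt e)

  -- c : Fin n → Fin n' realises the contraction of the components of L:
  -- the vertices of G' are the classes "same component of L"
  -- (a vertex not on any edge of L is its own class)
  IsContraction : ∀ {n'} → Subset m → (Fin n → Fin n') → Set
  IsContraction L c =
    Surjective _≡_ _≡_ c × (∀ u v → (c u ≡ c v) ⇔ Connected L u v)

contractEnds : ∀ {n n' m} → Ends n m → (Fin n → Fin n') → Ends n' m
contractEnds ends c e = c (proj₁ (ends e)) , c (proj₂ (ends e))

-- Suppose L' were a nonempty clump of F' in G'. Then L ∪ L' is a clump of F in G,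
-- strictly larger than L because no edge of F' lies inside a component of L;
-- this contradicts the maximality of L. Rank is additive: if T spans L in G and
-- T' spans L' in G', then T ∪ T' spans L ∪ L' in G. It connects the endpoints of
-- every edge because a walk of G' lifts to G by reconnecting the contracted
-- components through T, and it is a forest because deleting the T-edges from a
-- cycle of T ∪ T' leaves a cycle of T' in G' (or, if no T'-edge is left, the
-- cycle lies in T).
module Submission where

open import Defs
open import Data.Nat using (ℕ; _≤_; _+_; _*_; suc)
open import Data.Nat.Properties using (+-suc; *-distribˡ-+)
open import Data.Fin using (Fin)
open import Data.Fin.Subset using (Subset; _∈_; _∉_; _⊆_; Empty; _∪_; ∣_∣; inside; outside)
open import Data.Fin.Subset.Properties using (_∈?_; x∈p∪q⁻; p⊆p∪q; q⊆p∪q)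
open import Data.Vec.Base using ([]; _∷_; here; there)
open import Data.Product using (∃-syntax; _×_; _,_; proj₁; proj₂)
open import Data.Sum using (inj₁; inj₂; [_,_]′)
open import Data.Empty using (⊥-elim)
open import Data.List using ([]; _∷_; _++_; filter)
open import Data.List.Relation.Unary.Unique.Propositional using (Unique)
open import Data.List.Relation.Unary.Unique.Propositional.Properties using (filter⁺)
open import Relation.Binary.PropositionalEquality
  using (_≡_; _≢_; refl; sym; trans; cong; cong₂; subst; subst₂; module ≡-Reasoning)
open import Relation.Nullary using (¬_; yes; no)
open import Function.Bundles using (_⇔_; Equivalence)
open Equivalence

∪-least : ∀ {n} {p q r : Subset n} → p ⊆ r → q ⊆ r → p ∪ q ⊆ r
∪-least {p = p} {q} p⊆r q⊆r x∈p∪q = [ p⊆r , q⊆r ]′ (x∈p∪q⁻ p q x∈p∪q)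

∪-mono : ∀ {n} {p p′ q q′ : Subset n} → p ⊆ p′ → q ⊆ q′ → p ∪ q ⊆ p′ ∪ q′
∪-mono {p′ = p′} {q′ = q′} p⊆p′ q⊆q′ =
  ∪-least (λ x∈p → p⊆p∪q q′ (p⊆p′ x∈p)) (λ x∈q → q⊆p∪q p′ q′ (q⊆q′ x∈q))

x∈p∪q∧x∉q⇒x∈p : ∀ {n x} (p q : Subset n) → x ∈ p ∪ q → x ∉ q → x ∈ p
x∈p∪q∧x∉q⇒x∈p p q x∈p∪q x∉q = [ (λ x∈p → x∈p) , (λ x∈q → ⊥-elim (x∉q x∈q)) ]′ (x∈p∪q⁻ p q x∈p∪q)

∣p∪q∣≡∣p∣+∣q∣ : ∀ {n} (p q : Subset n) → (∀ {x} → x ∈ p → x ∉ q) → ∣ p ∪ q ∣ ≡ ∣ p ∣ + ∣ q ∣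
∣p∪q∣≡∣p∣+∣q∣ []            []            _        = refl
∣p∪q∣≡∣p∣+∣q∣ (inside  ∷ p) (inside  ∷ q) disjoint = ⊥-elim (disjoint here here)
∣p∪q∣≡∣p∣+∣q∣ (inside  ∷ p) (outside ∷ q) disjoint =
  cong suc (∣p∪q∣≡∣p∣+∣q∣ p q (λ x∈p x∈q → disjoint (there x∈p) (there x∈q)))
∣p∪q∣≡∣p∣+∣q∣ (outside ∷ p) (inside  ∷ q) disjoint =
  trans (cong suc (∣p∪q∣≡∣p∣+∣q∣ p q (λ x∈p x∈q → disjoint (there x∈p) (there x∈q))))
        (sym (+-suc ∣ p ∣ ∣ q ∣))
∣p∪q∣≡∣p∣+∣q∣ (outside ∷ p) (outside ∷ q) disjoint =
  ∣p∪q∣≡∣p∣+∣q∣ p q (λ x∈p x∈q → disjoint (there x∈p) (there x∈q))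

module Walks {n m : ℕ} (ends : Ends n m) where

  _++ʷ_ : ∀ {A u v w es fs} → Walk ends A u v es → Walk ends A v w fs → Walk ends A u w (es ++ fs)
  []             ++ʷ q = q
  step e∈A j p   ++ʷ q = step e∈A j (p ++ʷ q)

  Connected-trans : ∀ {A u v w} → Connected ends A u v → Connected ends A v w → Connected ends A u w
  Connected-trans (_ , p) (_ , q) = _ , p ++ʷ q

  Joins-sym : ∀ {e u w} → Joins ends e u w → Joins ends e w u
  Joins-sym (inj₁ eq) = inj₂ eq
  Joins-sym (inj₂ eq) = inj₁ eq

  Connected-step : ∀ {A e u w} → e ∈ A → Joins ends e u w → Connected ends A u w
  Connected-step e∈A j = _ , step e∈A j []

  Connected-edge : ∀ {A e} → e ∈ A → Connected ends A (src ends e) (tgt ends e)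
  Connected-edge e∈A = Connected-step e∈A (inj₁ refl)

  Walk-reverse : ∀ {A u v es} → Walk ends A u v es → Connected ends A v u
  Walk-reverse []             = _ , []
  Walk-reverse (step e∈A j p) = Connected-trans (Walk-reverse p) (Connected-step e∈A (Joins-sym j))

  Connected-sym : ∀ {A u v} → Connected ends A u v → Connected ends A v u
  Connected-sym (_ , p) = Walk-reverse p

  Walk-mono : ∀ {A B u v es} → A ⊆ B → Walk ends A u v es → Walk ends B u v es
  Walk-mono A⊆B []             = []
  Walk-mono A⊆B (step e∈A j p) = step (A⊆B e∈A) j (Walk-mono A⊆B p)

  Connected-mono : ∀ {A B u v} → A ⊆ B → Connected ends A u v → Connected ends B u v
  Connected-mono A⊆B (_ , p) = _ , Walk-mono A⊆B p

  Connected-joins : ∀ {T e u w} → Joins ends e u w →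
                    Connected ends T (src ends e) (tgt ends e) → Connected ends T u w
  Connected-joins (inj₁ eq) conn = subst₂ (Connected ends _) (cong proj₁ eq) (cong proj₂ eq) conn
  Connected-joins (inj₂ eq) conn =
    Connected-sym (subst₂ (Connected ends _) (cong proj₁ eq) (cong proj₂ eq) conn)

  Connected-spanned : ∀ {A T u v} → (∀ {e} → e ∈ A → Connected ends T (src ends e) (tgt ends e)) →
                      Connected ends A u v → Connected ends T u v
  Connected-spanned {A} {T} spans (_ , p) = go p
    where
    go : ∀ {u v es} → Walk ends A u v es → Connected ends T u v
    go []             = _ , []
    go (step e∈A j q) = Connected-trans (Connected-joins j (spans e∈A)) (go q)

  InsideSomeComponent-∈ : ∀ {L e} → e ∈ L → InsideSomeComponent ends L e
  InsideSomeComponent-∈ e∈L = (_ , e∈L , inj₁ refl) , Connected-edge e∈L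

module Contraction {n n' m : ℕ} (ends : Ends n m) (c : Fin n → Fin n') where

  open Walks ends

  private
    ends' : Ends n' m
    ends' = contractEnds ends c

  Joins-contract : ∀ {e u w} → Joins ends e u w → Joins ends' e (c u) (c w)
  Joins-contract (inj₁ eq) = inj₁ (cong (λ uw → c (proj₁ uw) , c (proj₂ uw)) eq)
  Joins-contract (inj₂ eq) = inj₂ (cong (λ uw → c (proj₁ uw) , c (proj₂ uw)) eq)

  module _ (T T' : Subset m) where

    Walk-contract : (∀ {e} → e ∈ T → c (src ends e) ≡ c (tgt ends e)) →
                    ∀ {u v es} → Walk ends (T ∪ T') u v es →
                    Walk ends' T' (c u) (c v) (filter (_∈? T') es)
    Walk-contract collapses [] = []
    Walk-contract collapses (step {u} {w} {v} {e} e∈T∪T' j p) with e ∈? T'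
    ... | yes e∈T' = step e∈T' (Joins-contract j) (Walk-contract collapses p)
    ... | no  e∉T' = subst (λ x → Walk ends' T' x (c v) _) (sym cu≡cw) (Walk-contract collapses p)
      where
      cu≡cw : c u ≡ c w
      cu≡cw with Joins-contract j | collapses (x∈p∪q∧x∉q⇒x∈p T T' e∈T∪T' e∉T')
      ... | inj₁ eq | collapsed = trans (sym (cong proj₁ eq)) (trans collapsed (cong proj₂ eq))
      ... | inj₂ eq | collapsed = trans (sym (cong proj₂ eq)) (trans (sym collapsed) (cong proj₁ eq))

    Walk-avoiding : ∀ {u v es} → filter (_∈? T') es ≡ [] →
                    Walk ends (T ∪ T') u v es → Walk ends T u v es
    Walk-avoiding none [] = []
    Walk-avoiding none (step {e = e} e∈T∪T' j p) with e ∈? T'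
    Walk-avoiding ()   (step e∈T∪T' j p) | yes _
    ... | no e∉T' = step (x∈p∪q∧x∉q⇒x∈p T T' e∈T∪T' e∉T') j (Walk-avoiding none p)

    IsForest-∪-contract : (∀ {e} → e ∈ T → c (src ends e) ≡ c (tgt ends e)) →
                          IsForest ends T → IsForest ends' T' → IsForest ends (T ∪ T')
    IsForest-∪-contract collapses forestT forestT' (v , e , es , cycle , unique)
      with filter (_∈? T') (e ∷ es) in eq
    ... | []     = forestT (v , e , es , Walk-avoiding eq cycle , unique)
    ... | x ∷ xs = forestT' (c v , x , xs ,
                             subst (Walk ends' T' (c v) (c v)) eq (Walk-contract collapses cycle) ,
                             subst Unique eq (filter⁺ (_∈? T') unique))

    Connected-lift : (∀ {u v} → c u ≡ c v → Connected ends T u v) →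
                     ∀ {u v} → Connected ends' T' (c u) (c v) → Connected ends (T ∪ T') u v
    Connected-lift classes (_ , p) = go p refl refl
      where
      within : ∀ {u v} → c u ≡ c v → Connected ends (T ∪ T') u v
      within cu≡cv = Connected-mono (p⊆p∪q T') (classes cu≡cv)

      go : ∀ {x y es} → Walk ends' T' x y es → ∀ {u v} → c u ≡ x → c v ≡ y →
           Connected ends (T ∪ T') u v
      go [] cu≡x cv≡x = within (trans cu≡x (sym cv≡x))
      go (step {e = e} e∈T' (inj₁ eq) q) cu≡x cv≡y =
        Connected-trans (within (trans cu≡x (sym (cong proj₁ eq))))
          (Connected-trans (Connected-edge (q⊆p∪q T T' e∈T')) (go q (cong proj₂ eq) cv≡y))
      go (step {e = e} e∈T' (inj₂ eq) q) cu≡x cv≡y =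
        Connected-trans (within (trans cu≡x (sym (cong proj₂ eq))))
          (Connected-trans (Connected-sym (Connected-edge (q⊆p∪q T T' e∈T')))
                           (go q (cong proj₁ eq) cv≡y))

  module _ {L L' : Subset m} (contracts : ∀ u v → (c u ≡ c v) ⇔ Connected ends L u v)
           (disjoint : ∀ {e} → e ∈ L → e ∉ L') where

    HasRank-∪-contract : ∀ {r r'} → HasRank ends L r → HasRank ends' L' r' →
                         HasRank ends (L ∪ L') (r + r')
    HasRank-∪-contract (T , (T⊆L , forestT , spansT) , ∣T∣≡r)
                       (T' , (T'⊆L' , forestT' , spansT') , ∣T'∣≡r') =
      T ∪ T' , (∪-mono T⊆L T'⊆L' , IsForest-∪-contract T T' collapses forestT forestT' , spans) ,
      trans (∣p∪q∣≡∣p∣+∣q∣ T T' (λ e∈T e∈T' → disjoint (T⊆L e∈T) (T'⊆L' e∈T')))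
            (cong₂ _+_ ∣T∣≡r ∣T'∣≡r')
      where
      collapses : ∀ {e} → e ∈ T → c (src ends e) ≡ c (tgt ends e)
      collapses e∈T = from (contracts _ _) (Connected-edge (T⊆L e∈T))

      classes : ∀ {u v} → c u ≡ c v → Connected ends T u v
      classes cu≡cv = Connected-spanned spansT (to (contracts _ _) cu≡cv)

      spans : ∀ {e} → e ∈ L ∪ L' → Connected ends (T ∪ T') (src ends e) (tgt ends e)
      spans {e} e∈L∪L' with x∈p∪q⁻ L L' e∈L∪L'
      ... | inj₁ e∈L  = Connected-mono (p⊆p∪q T') (spansT e∈L)
      ... | inj₂ e∈L' = Connected-lift T T' classes (spansT' e∈L')

    IsClump-∪-contract : ∀ {k F F'} → CoveredByForests ends k F → F' ⊆ F →
                         IsClump ends k F L → IsClump ends' k F' L' → IsClump ends k F (L ∪ L')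
    IsClump-∪-contract {k} {F} (Fs , forests , covers) F'⊆F
                       (L⊆F , _ , r , rankL , ∣L∣≡kr) (L'⊆F' , _ , r' , rankL' , ∣L'∣≡kr') =
      L∪L'⊆F , (Fs , forests , λ e∈L∪L' → covers (L∪L'⊆F e∈L∪L')) ,
      r + r' , HasRank-∪-contract rankL rankL' , ∣L∪L'∣≡k[r+r']
      where
      open ≡-Reasoning

      L∪L'⊆F : L ∪ L' ⊆ F
      L∪L'⊆F = ∪-least L⊆F (λ e∈L' → F'⊆F (L'⊆F' e∈L'))

      ∣L∪L'∣≡k[r+r'] : ∣ L ∪ L' ∣ ≡ k * (r + r')
      ∣L∪L'∣≡k[r+r'] = begin
        ∣ L ∪ L' ∣         ≡⟨ ∣p∪q∣≡∣p∣+∣q∣ L L' disjoint ⟩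
        ∣ L ∣ + ∣ L' ∣     ≡⟨ cong₂ _+_ ∣L∣≡kr ∣L'∣≡kr' ⟩
        k * r + k * r'     ≡⟨ *-distribˡ-+ k r r' ⟨
        k * (r + r')       ∎

lemma4 : {n m : ℕ} (ends : Ends n m) (k : ℕ) → 1 ≤ k →
    (Fs : Fin k → Subset m) → ((i : Fin k) → IsForest ends (Fs i)) →
    (∀ {i j e} → i ≢ j → e ∈ Fs i → e ∉ Fs j) →
    (F : Subset m) → (∀ e → e ∈ F ⇔ (∃[ i ] (e ∈ Fs i))) →
    (L : Subset m) → IsTopClump ends k F L →
    {n' : ℕ} (c : Fin n → Fin n') → IsContraction ends L c →
    (Fs' : Fin k → Subset m) →
    (∀ i e → e ∈ Fs' i ⇔ (e ∈ Fs i × ¬ InsideSomeComponent ends L e)) →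
    (F' : Subset m) → (∀ e → e ∈ F' ⇔ (∃[ i ] (e ∈ Fs' i))) →
    ∀ L' → IsClump (contractEnds ends c) k F' L' → Empty L'
lemma4 ends k _ Fs forests _ F F≡⋃Fs L (clumpL , maximal) c (_ , contracts) Fs' Fs'≡Fs-inside
       F' F'≡⋃Fs' L' clumpL' (e , e∈L') =
  disjoint (maximal (L ∪ L') clumpL∪L' (p⊆p∪q L') (q⊆p∪q L L' e∈L')) e∈L'
  where
  open Walks ends using (InsideSomeComponent-∈)

  F'⊆F : F' ⊆ F
  F'⊆F {e} e∈F' with to (F'≡⋃Fs' e) e∈F'
  ... | i , e∈Fs'i = from (F≡⋃Fs e) (i , proj₁ (to (Fs'≡Fs-inside i e) e∈Fs'i))

  disjoint : ∀ {e} → e ∈ L → e ∉ L'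
  disjoint {e} e∈L e∈L' with to (F'≡⋃Fs' e) (proj₁ clumpL' e∈L')
  ... | i , e∈Fs'i = proj₂ (to (Fs'≡Fs-inside i e) e∈Fs'i) (InsideSomeComponent-∈ e∈L)

  clumpL∪L' : IsClump ends k F (L ∪ L')
  clumpL∪L' = Contraction.IsClump-∪-contract ends c contracts disjoint
                (Fs , forests , λ e∈F → to (F≡⋃Fs _) e∈F) F'⊆F clumpL clumpL'
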